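{- Let $r\ge 2$ be an integer that is not a perfect square, $\alpha=\sqrt{r}$, $c=1/\alpha$, $s=\lfloor\alpha\rfloor$, $\beta=\alpha-s\in(0,1)$, and \[ N(r)=\#\{1\le j\le r-1:\ \{j/\alpha\}<\beta\}. \] Then \[ 2\sum_{j=1}^{r-1}\lfloor jc\rfloor=(r-1)(s-1)+N(r), \] and the inequality $N(r)<r\beta+s-1$ is equivalent to \[ \sum_{j=1}^{r-1}\{jc\}>\frac{r-\alpha}{2}. \]
   Context: $\{x\}=x-\lfloor x\rfloor$ denotes the fractional part. -}

module Defs where

-- An element  ⟨ a , b ⟩  denotes the real number  a + b·√r  (a b : ℚ).
-- Only the Q-linear structure and the (real) order are needed.

open import Data.Bool using (Bool; true; false; _∧_; _∨_; not; T)
open import Data.Nat as ℕ using (ℕ; suc; _∸_)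
open import Data.Integer as ℤ using (ℤ)
open import Data.Rational as ℚ using (ℚ; 0ℚ; 1ℚ; _≤ᵇ_)
open import Data.List using (List; []; _∷_; map; foldr; filter; length; upTo)
open import Relation.Nullary.Decidable using (Dec; yes; no)
open import Relation.Unary using (Pred; Decidable)

record QS : Set where
  constructor ⟨_,_⟩
  field
    re : ℚ
    im : ℚ

open QS public

ℚ→QS : ℚ → QS
ℚ→QS q = ⟨ q , 0ℚ ⟩

ℤ→QS : ℤ → QS
ℤ→QS z = ℚ→QS (z ℚ./ 1)

ℕ→QS : ℕ → QS
ℕ→QS n = ℤ→QS (ℤ.+ n)

√ : QS
√ = ⟨ 0ℚ , 1ℚ ⟩

infixl 6 _+Q_ _-Q_
infixl 7 _·Q_

_+Q_ : QS → QS → QS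
⟨ a , b ⟩ +Q ⟨ c , d ⟩ = ⟨ a ℚ.+ c , b ℚ.+ d ⟩

-Q_ : QS → QS
-Q ⟨ a , b ⟩ = ⟨ ℚ.- a , ℚ.- b ⟩

_-Q_ : QS → QS → QS
x -Q y = x +Q (-Q y)

_·Q_ : ℚ → QS → QS
q ·Q ⟨ a , b ⟩ = ⟨ q ℚ.* a , q ℚ.* b ⟩

0Q : QS
0Q = ℚ→QS 0ℚ

_<ᵇ_ : ℚ → ℚ → Bool
p <ᵇ q = not (q ≤ᵇ p)

isPos : ℕ → QS → Bool
isPos r ⟨ a , b ⟩ =
  ((0ℚ <ᵇ a) ∧ ((0ℚ ≤ᵇ b) ∨ ((b ℚ.* b ℚ.* R) <ᵇ (a ℚ.* a))))
  ∨ ((a ≤ᵇ 0ℚ) ∧ ((0ℚ <ᵇ b) ∧ ((a ℚ.* a) <ᵇ (b ℚ.* b ℚ.* R))))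
  where R = ℤ.+ r ℚ./ 1

_<[_]_ : QS → ℕ → QS → Set
x <[ r ] y = T (isPos r (y -Q x))

_≤[_]_ : QS → ℕ → QS → Set
x ≤[ r ] y = T (not (isPos r (x -Q y)))

IsFloor : ℕ → QS → ℤ → Set
IsFloor r x n = (ℤ→QS n ≤[ r ] x) Data.Product.× (x <[ r ] ℤ→QS (n ℤ.+ ℤ.1ℤ))
  where import Data.Product

range : ℕ → List ℕ
range r = map suc (upTo (r ∸ 1))

sumℤ : List ℤ → ℤ
sumℤ = foldr ℤ._+_ ℤ.0ℤ

sumQ : List QS → QS
sumQ = foldr _+Q_ 0Q

-- c = 1/√r = (1/r)·√r, so j·c = (j/r)·√r.
-- (r = 0 is a junk case; the theorem assumes r ≥ 2.)
jc : ℕ → ℕ → QS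
jc ℕ.zero    j = 0Q
jc (suc r′) j = ((ℤ.+ j) ℚ./ suc r′) ·Q √

frac : QS → ℤ → QS
frac x n = x -Q ℤ→QS n

count : {A : Set} → (A → Bool) → List A → ℕ
count p [] = 0
count p (x ∷ xs) with p x
... | true  = suc (count p xs)
... | false = count p xs

Ncount : (r : ℕ) → (s : ℤ) → (fl : ℕ → ℤ) → ℕ
Ncount r s fl =
  count (λ j → isPos r ((√ -Q ℤ→QS s) -Q frac (jc r j) (fl j))) (range r)

-- Pair j with k = r − j. Since jc + kc = rc = √r = s + β, the floors satisfy
-- ⌊jc⌋ + ⌊kc⌋ ∈ {s − 1, s}, and because √r is irrational (so {kc} ≠ 0) the sum is s
-- exactly when {jc} < β. Summing over all pairs gives 2∑⌊jc⌋ = (r − 1)(s − 1) + N(r).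
-- Pairing once more, j/r + k/r = 1 gives ∑ jc = (r − 1)√r / 2, hence
-- ∑{jc} − (r − √r)/2 = (rβ + s − 1 − N(r)) / 2, and the two inequalities are the same.
-- Positivity in ℚ(√r) (the Boolean isPos) is translated into comparisons of squares
-- of integers, so that the floor computations take place in ℕ.
module Submission where

open import Defs
open import Data.Nat as ℕ using (ℕ; _≤_; _∸_)
open import Data.Integer as ℤ using (ℤ)
open import Data.Rational as ℚ using (ℚ)
open import Data.List using (map)
open import Data.Product using (Σ; _×_)
open import Relation.Nullary using (¬_)
open import Relation.Binary.PropositionalEquality using (_≡_)
open import Function.Bundles using (_⇔_)

open import Algebra.Bundles using (CommutativeMonoid)
import Algebra.Properties.CommutativeMonoid.Sum as CommutativeMonoidSum
open import Data.Bool using (Bool; true; false; T; not)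
open import Data.Bool.Properties using (T-∧; T-∨; T-≡; T-not-≡)
open import Data.Empty using (⊥-elim)
open import Data.Fin using (Fin; toℕ; opposite)
import Data.Fin.Permutation as Perm
open import Data.Fin.Properties using (toℕ<n; opposite-prop)
open import Data.Integer using (+_; -[1+_]; +<+)
import Data.Integer.Properties as ℤP
open import Data.Integer.Tactic.RingSolver using () renaming (solve-∀ to ℤ-solve-∀)
open import Data.List using (List; []; _∷_; foldr; length; upTo; applyUpTo)
open import Data.List.Properties using (map-∘; map-cong; map-upTo; length-map; length-upTo)
open import Data.Nat using (suc; zero; z≤n; s≤s; _+_; _*_; _<_)
open import Data.Nat.Coprimality using (Coprime; GCD≡1⇒coprime; coprime-divisor)
open import Data.Nat.Divisibility using (_∣_; divides; ∣-refl)
open import Data.Nat.GCD using (gcd; gcd-GCD; GCD; GCD-*; gcd[m,n]∣m; gcd[m,n]∣n; gcd[m,n]≢0)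
import Data.Nat.Properties as ℕP
open import Data.Nat.Tactic.RingSolver using () renaming (solve to ℕ-solve; solve-∀ to ℕ-solve-∀)
open import Data.Product using (_,_; proj₁; proj₂; map₂)
open import Data.Product.Function.NonDependent.Propositional using (_×-⇔_)
open import Data.Rational using (0ℚ; 1ℚ; ½; Positive)
import Data.Rational.Properties as ℚP
open import Data.Rational.Solver using (module +-*-Solver)
open import Data.Rational.Unnormalised as ℚᵘ using (mkℚᵘ; *≡*; *<*)
import Data.Rational.Unnormalised.Properties as ℚᵘP
open import Data.Sum using (_⊎_; inj₁; inj₂; [_,_]′)
open import Data.Sum.Function.Propositional using (_⊎-⇔_)
open import Data.Unit using (tt)
open import Function using (_∘_; case_of_; mk⇔; Equivalence)
import Function.Properties.Equivalence as ⇔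
open import Relation.Binary.PropositionalEquality
  using (_≢_; refl; sym; trans; cong; cong₂; subst; subst₂; module ≡-Reasoning)
import Relation.Binary.Reasoning.Setoid as SetoidReasoning
open import Relation.Nullary.Decidable using (yes; no)

open +-*-Solver using (solve; con; _:+_; _:*_; :-_; _:-_; _:=_)

≡⇒⇔ : ∀ {A B : Set} → A ≡ B → A ⇔ B
≡⇒⇔ refl = ⇔.refl

toℚ : ℤ → ℚ
toℚ z = z ℚ./ 1

toℚᵘ-toℚ : ∀ z → ℚ.toℚᵘ (toℚ z) ℚᵘ.≃ mkℚᵘ z 0
toℚᵘ-toℚ z = ℚP.toℚᵘ-fromℚᵘ (mkℚᵘ z 0)

toℚ-homo-+ : ∀ x y → toℚ (x ℤ.+ y) ≡ toℚ x ℚ.+ toℚ y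
toℚ-homo-+ x y = ℚP.toℚᵘ-injective (begin
  ℚ.toℚᵘ (toℚ (x ℤ.+ y))                ≈⟨ toℚᵘ-toℚ (x ℤ.+ y) ⟩
  mkℚᵘ (x ℤ.+ y) 0                      ≈⟨ *≡* (lemma x y) ⟩
  mkℚᵘ x 0 ℚᵘ.+ mkℚᵘ y 0                ≈⟨ ℚᵘP.+-cong (toℚᵘ-toℚ x) (toℚᵘ-toℚ y) ⟨
  ℚ.toℚᵘ (toℚ x) ℚᵘ.+ ℚ.toℚᵘ (toℚ y)    ≈⟨ ℚP.toℚᵘ-homo-+ (toℚ x) (toℚ y) ⟨
  ℚ.toℚᵘ (toℚ x ℚ.+ toℚ y)              ∎)
  where
  open ℚᵘP.≃-Reasoning
  lemma : ∀ x y → (x ℤ.+ y) ℤ.* ℤ.1ℤ ≡ (x ℤ.* ℤ.1ℤ ℤ.+ y ℤ.* ℤ.1ℤ) ℤ.* ℤ.1ℤ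
  lemma = ℤ-solve-∀

toℚ-homo-* : ∀ x y → toℚ (x ℤ.* y) ≡ toℚ x ℚ.* toℚ y
toℚ-homo-* x y = ℚP.toℚᵘ-injective (begin
  ℚ.toℚᵘ (toℚ (x ℤ.* y))                ≈⟨ toℚᵘ-toℚ (x ℤ.* y) ⟩
  mkℚᵘ (x ℤ.* y) 0                      ≈⟨ ℚᵘP.*-cong (toℚᵘ-toℚ x) (toℚᵘ-toℚ y) ⟨
  ℚ.toℚᵘ (toℚ x) ℚᵘ.* ℚ.toℚᵘ (toℚ y)    ≈⟨ ℚP.toℚᵘ-homo-* (toℚ x) (toℚ y) ⟨
  ℚ.toℚᵘ (toℚ x ℚ.* toℚ y)              ∎)
  where open ℚᵘP.≃-Reasoning

toℚ-homo‿- : ∀ x → toℚ (ℤ.- x) ≡ ℚ.- toℚ x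
toℚ-homo‿- x = ℚP.toℚᵘ-injective (begin
  ℚ.toℚᵘ (toℚ (ℤ.- x))     ≈⟨ toℚᵘ-toℚ (ℤ.- x) ⟩
  mkℚᵘ (ℤ.- x) 0           ≈⟨ ℚᵘP.-‿cong (toℚᵘ-toℚ x) ⟨
  ℚᵘ.- ℚ.toℚᵘ (toℚ x)      ≈⟨ ℚP.toℚᵘ-homo‿- (toℚ x) ⟨
  ℚ.toℚᵘ (ℚ.- toℚ x)       ∎)
  where open ℚᵘP.≃-Reasoning

toℚ-<-⇔ : ∀ {x y} → (toℚ x ℚ.< toℚ y) ⇔ (x ℤ.< y)
toℚ-<-⇔ {x} {y} = ⇔.trans (mk⇔ to-ℚᵘ from-ℚᵘ)
  (⇔.trans (mk⇔ ℚᵘP.drop-*<* *<*) (≡⇒⇔ (cong₂ ℤ._<_ (ℤP.*-identityʳ x) (ℤP.*-identityʳ y))))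
  where
  to-ℚᵘ : toℚ x ℚ.< toℚ y → mkℚᵘ x 0 ℚᵘ.< mkℚᵘ y 0
  to-ℚᵘ x<y = ℚᵘP.<-respˡ-≃ (toℚᵘ-toℚ x) (ℚᵘP.<-respʳ-≃ (toℚᵘ-toℚ y) (ℚP.toℚᵘ-mono-< x<y))
  from-ℚᵘ : mkℚᵘ x 0 ℚᵘ.< mkℚᵘ y 0 → toℚ x ℚ.< toℚ y
  from-ℚᵘ x<y = ℚP.toℚᵘ-cancel-< (ℚᵘP.<-respˡ-≃ (ℚᵘP.≃-sym (toℚᵘ-toℚ x))
                  (ℚᵘP.<-respʳ-≃ (ℚᵘP.≃-sym (toℚᵘ-toℚ y)) x<y))

*-cancelˡ-<-⇔ : ∀ d .{{_ : Positive d}} {p q} → (d ℚ.* p ℚ.< d ℚ.* q) ⇔ (p ℚ.< q)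
*-cancelˡ-<-⇔ d = mk⇔ (ℚP.*-cancelˡ-<-nonNeg d {{ℚP.pos⇒nonNeg d}}) (ℚP.*-monoʳ-<-pos d)

*-cancelˡ-≤-⇔ : ∀ d .{{_ : Positive d}} {p q} → (d ℚ.* p ℚ.≤ d ℚ.* q) ⇔ (p ℚ.≤ q)
*-cancelˡ-≤-⇔ d = mk⇔ (ℚP.*-cancelˡ-≤-pos d) (ℚP.*-monoˡ-≤-nonNeg d {{ℚP.pos⇒nonNeg d}})

x+x≡y⇒x≡½y : ∀ {x y} → x ℚ.+ x ≡ y → x ≡ ½ ℚ.* y
x+x≡y⇒x≡½y {x} x+x≡y = trans (x≡½[x+x] x) (cong (½ ℚ.*_) x+x≡y)
  where
  x≡½[x+x] : ∀ x → x ≡ ½ ℚ.* (x ℚ.+ x)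
  x≡½[x+x] = solve 1 (λ x → x := con ½ :* (x :+ x)) refl

T-not-⇔ : ∀ {b} → T (not b) ⇔ (¬ T b)
T-not-⇔ {true}  = mk⇔ (λ ()) (λ ¬t → ¬t tt)
T-not-⇔ {false} = mk⇔ (λ _ ()) (λ _ → tt)

T-≤ᵇ : ∀ {p q} → T (p ℚ.≤ᵇ q) ⇔ (p ℚ.≤ q)
T-≤ᵇ = mk⇔ ℚP.≤ᵇ⇒≤ ℚP.≤⇒≤ᵇ

T-<ᵇ : ∀ {p q} → T (p <ᵇ q) ⇔ (p ℚ.< q)
T-<ᵇ = ⇔.trans T-not-⇔ (mk⇔ (λ q≰p → ℚP.≰⇒> (q≰p ∘ ℚP.≤⇒≤ᵇ)) (λ p<q → <⇒≱ p<q ∘ ℚP.≤ᵇ⇒≤))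
  where
  <⇒≱ : ∀ {p q} → p ℚ.< q → ¬ q ℚ.≤ p
  <⇒≱ p<q q≤p = ℚP.<-irrefl refl (ℚP.<-≤-trans p<q q≤p)

module _ (r : ℕ) where
  private
    R : ℚ
    R = toℚ (+ r)

  isPos-⇔ : ∀ a b → T (isPos r ⟨ a , b ⟩)
              ⇔ (0ℚ ℚ.< a × (0ℚ ℚ.≤ b ⊎ b ℚ.* b ℚ.* R ℚ.< a ℚ.* a)
                 ⊎ a ℚ.≤ 0ℚ × 0ℚ ℚ.< b × a ℚ.* a ℚ.< b ℚ.* b ℚ.* R)
  isPos-⇔ a b = ⇔.trans T-∨
    (⇔.trans T-∧ (T-<ᵇ ×-⇔ ⇔.trans T-∨ (T-≤ᵇ ⊎-⇔ T-<ᵇ))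
     ⊎-⇔ ⇔.trans T-∧ (T-≤ᵇ ×-⇔ ⇔.trans T-∧ (T-<ᵇ ×-⇔ T-<ᵇ)))

  isPos-im<0-⇔ : ∀ {a b} → b ℚ.< 0ℚ → T (isPos r ⟨ a , b ⟩) ⇔ (0ℚ ℚ.< a × b ℚ.* b ℚ.* R ℚ.< a ℚ.* a)
  isPos-im<0-⇔ {a} {b} b<0 = ⇔.trans (isPos-⇔ a b) (mk⇔
    [ (λ { (0<a , inj₁ 0≤b)     → ⊥-elim (ℚP.<-irrefl refl (ℚP.<-≤-trans b<0 0≤b))
         ; (0<a , inj₂ b²R<a²)  → 0<a , b²R<a² })
    , (λ { (_ , 0<b , _) → ⊥-elim (ℚP.<-asym b<0 0<b) }) ]′
    (inj₁ ∘ map₂ inj₂))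

  isPos-im>0-⇔ : ∀ {a b} → 0ℚ ℚ.< b → T (isPos r ⟨ a , b ⟩) ⇔ (0ℚ ℚ.< a ⊎ a ℚ.* a ℚ.< b ℚ.* b ℚ.* R)
  isPos-im>0-⇔ {a} {b} 0<b = ⇔.trans (isPos-⇔ a b) (mk⇔
    [ inj₁ ∘ proj₁ , inj₂ ∘ proj₂ ∘ proj₂ ]′
    [ (λ 0<a → inj₁ (0<a , inj₁ 0≤b))
    , (λ a²<b²R → case a ℚP.≤? 0ℚ of λ
         { (yes a≤0) → inj₂ (a≤0 , 0<b , a²<b²R)
         ; (no a≰0)  → inj₁ (ℚP.≰⇒> a≰0 , inj₁ 0≤b) }) ]′)
    where
    0≤b : 0ℚ ℚ.≤ b
    0≤b = ℚP.<⇒≤ 0<b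

isPos-scale-⇔ : ∀ r d .{{_ : Positive d}} x → T (isPos r (d ·Q x)) ⇔ T (isPos r x)
isPos-scale-⇔ r d ⟨ a , b ⟩ = ⇔.trans (isPos-⇔ r (d ℚ.* a) (d ℚ.* b))
  (⇔.trans ((pos ×-⇔ (nonNeg ⊎-⇔ squares (sq-R d b R) (sq d a)))
            ⊎-⇔ (nonPos ×-⇔ (pos ×-⇔ squares (sq d a) (sq-R d b R))))
           (⇔.sym (isPos-⇔ r a b)))
  where
  R : ℚ
  R = toℚ (+ r)
  instance
    d²-pos : Positive (d ℚ.* d)
    d²-pos = ℚP.pos*pos⇒pos d d
  pos : ∀ {x} → (0ℚ ℚ.< d ℚ.* x) ⇔ (0ℚ ℚ.< x)
  pos {x} = ⇔.trans (≡⇒⇔ (cong (ℚ._< d ℚ.* x) (sym (ℚP.*-zeroʳ d)))) (*-cancelˡ-<-⇔ d)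
  nonNeg : ∀ {x} → (0ℚ ℚ.≤ d ℚ.* x) ⇔ (0ℚ ℚ.≤ x)
  nonNeg {x} = ⇔.trans (≡⇒⇔ (cong (ℚ._≤ d ℚ.* x) (sym (ℚP.*-zeroʳ d)))) (*-cancelˡ-≤-⇔ d)
  nonPos : ∀ {x} → (d ℚ.* x ℚ.≤ 0ℚ) ⇔ (x ℚ.≤ 0ℚ)
  nonPos {x} = ⇔.trans (≡⇒⇔ (cong (d ℚ.* x ℚ.≤_) (sym (ℚP.*-zeroʳ d)))) (*-cancelˡ-≤-⇔ d)
  squares : ∀ {p p′ q q′} → p′ ≡ d ℚ.* d ℚ.* p → q′ ≡ d ℚ.* d ℚ.* q → (p′ ℚ.< q′) ⇔ (p ℚ.< q)
  squares p′≡ q′≡ = ⇔.trans (≡⇒⇔ (cong₂ ℚ._<_ p′≡ q′≡)) (*-cancelˡ-<-⇔ (d ℚ.* d))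
  sq : ∀ d x → d ℚ.* x ℚ.* (d ℚ.* x) ≡ d ℚ.* d ℚ.* (x ℚ.* x)
  sq = solve 2 (λ d x → d :* x :* (d :* x) := d :* d :* (x :* x)) refl
  sq-R : ∀ d x R → d ℚ.* x ℚ.* (d ℚ.* x) ℚ.* R ≡ d ℚ.* d ℚ.* (x ℚ.* x ℚ.* R)
  sq-R = solve 3 (λ d x R → d :* x :* (d :* x) :* R := d :* d :* (x :* x :* R)) refl

-- When t · r = β, the element ⟨ toℚ m , ± t ⟩ is the real number m ± β/√r.
module _ (r : ℕ) .{{_ : ℕ.NonZero r}} {t : ℚ} {β : ℤ} (tr≡β : t ℚ.* toℚ (+ r) ≡ toℚ β) (0<β : ℤ.0ℤ ℤ.< β) where
  private
    R : ℚ
    R = toℚ (+ r)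
    instance
      R-pos : Positive R
      R-pos = ℚP.normalize-pos r 1

    0<t : 0ℚ ℚ.< t
    0<t = ℚP.*-cancelʳ-<-nonNeg R {{ℚP.pos⇒nonNeg R}}
            (subst₂ ℚ._<_ (sym (ℚP.*-zeroˡ R)) (sym tr≡β) (Equivalence.from toℚ-<-⇔ 0<β))

    R*t²R≡β² : R ℚ.* (t ℚ.* t ℚ.* R) ≡ toℚ (β ℤ.* β)
    R*t²R≡β² = begin
      R ℚ.* (t ℚ.* t ℚ.* R)      ≡⟨ lemma R t ⟩
      (t ℚ.* R) ℚ.* (t ℚ.* R)    ≡⟨ cong₂ ℚ._*_ tr≡β tr≡β ⟩
      toℚ β ℚ.* toℚ β            ≡⟨ toℚ-homo-* β β ⟨
      toℚ (β ℤ.* β)              ∎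
      where
      open ≡-Reasoning
      lemma : ∀ R t → R ℚ.* (t ℚ.* t ℚ.* R) ≡ (t ℚ.* R) ℚ.* (t ℚ.* R)
      lemma = solve 2 (λ R t → R :* (t :* t :* R) := (t :* R) :* (t :* R)) refl

    R*m²≡m²r : ∀ m → R ℚ.* (toℚ m ℚ.* toℚ m) ≡ toℚ (m ℤ.* m ℤ.* + r)
    R*m²≡m²r m = begin
      R ℚ.* (toℚ m ℚ.* toℚ m)    ≡⟨ ℚP.*-comm R _ ⟩
      toℚ m ℚ.* toℚ m ℚ.* R      ≡⟨ cong (ℚ._* R) (toℚ-homo-* m m) ⟨
      toℚ (m ℤ.* m) ℚ.* R        ≡⟨ toℚ-homo-* (m ℤ.* m) (+ r) ⟨
      toℚ (m ℤ.* m ℤ.* + r)      ∎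
      where open ≡-Reasoning

  isPos-[m-β/√r]-⇔ : ∀ m → T (isPos r ⟨ toℚ m , ℚ.- t ⟩) ⇔ (ℤ.0ℤ ℤ.< m × β ℤ.* β ℤ.< m ℤ.* m ℤ.* + r)
  isPos-[m-β/√r]-⇔ m = ⇔.trans (isPos-im<0-⇔ r (ℚP.neg-antimono-< 0<t))
    (toℚ-<-⇔ ×-⇔ ⇔.trans (⇔.sym (*-cancelˡ-<-⇔ R))
                 (⇔.trans (≡⇒⇔ (cong₂ ℚ._<_ (trans (cong (R ℚ.*_) (neg² t R)) R*t²R≡β²) (R*m²≡m²r m))) toℚ-<-⇔))
    where
    neg² : ∀ t R → ℚ.- t ℚ.* ℚ.- t ℚ.* R ≡ t ℚ.* t ℚ.* R
    neg² = solve 2 (λ t R → :- t :* :- t :* R := t :* t :* R) refl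

  isPos-[m+β/√r]-⇔ : ∀ m → T (isPos r ⟨ toℚ m , t ⟩) ⇔ (ℤ.0ℤ ℤ.< m ⊎ m ℤ.* m ℤ.* + r ℤ.< β ℤ.* β)
  isPos-[m+β/√r]-⇔ m = ⇔.trans (isPos-im>0-⇔ r 0<t)
    (toℚ-<-⇔ ⊎-⇔ ⇔.trans (⇔.sym (*-cancelˡ-<-⇔ R))
                 (⇔.trans (≡⇒⇔ (cong₂ ℚ._<_ (R*m²≡m²r m) R*t²R≡β²)) toℚ-<-⇔))

-- x ·√ r ≤ j and j < x ·√ r compare j with x√r after squaring, so that they stay in ℕ;
-- ⌊ j /√ r ⌋≡ a says a = ⌊j/√r⌋, i.e. a = ⌊jc⌋ in the notation of the statement.
infix 4 _·√_≤_ _<_·√_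

_·√_≤_ : ℕ → ℕ → ℕ → Set
x ·√ r ≤ j = x * x * r ≤ j * j

_<_·√_ : ℕ → ℕ → ℕ → Set
j < x ·√ r = j * j < x * x * r

⌊_/√_⌋≡_ : ℕ → ℕ → ℕ → Set
⌊ j /√ r ⌋≡ a = a ·√ r ≤ j × j < suc a ·√ r

module _ {r : ℕ} where
  open ℕP.≤-Reasoning

  private
    square-cancel-≤ : ∀ {u v} → u * u ≤ v * v → u ≤ v
    square-cancel-≤ u²≤v² = ℕP.≮⇒≥ (λ v<u → ℕP.<⇒≱ (ℕP.*-mono-< v<u v<u) u²≤v²)

    square-cancel-< : ∀ {u v} → u * u < v * v → u < v
    square-cancel-< u²<v² = ℕP.≰⇒> (λ v≤u → ℕP.<⇒≱ u²<v² (ℕP.*-mono-≤ v≤u v≤u))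

    ·√-mono-≤ : ∀ {m n} → m ≤ n → m * m * r ≤ n * n * r
    ·√-mono-≤ m≤n = ℕP.*-monoˡ-≤ r (ℕP.*-mono-≤ m≤n m≤n)

  ·√≤-+ : ∀ {x y j k} → x ·√ r ≤ j → y ·√ r ≤ k → x + y ·√ r ≤ j + k
  ·√≤-+ {x} {y} {j} {k} x√r≤j y√r≤k = begin
    (x + y) * (x + y) * r                      ≡⟨ ℕ-solve (x ∷ y ∷ r ∷ []) ⟩
    x * x * r + 2 * (x * y * r) + y * y * r    ≤⟨ ℕP.+-mono-≤ (ℕP.+-mono-≤ x√r≤j (ℕP.*-monoʳ-≤ 2 xyr≤jk)) y√r≤k ⟩
    j * j + 2 * (j * k) + k * k                ≡⟨ ℕ-solve (j ∷ k ∷ []) ⟩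
    (j + k) * (j + k)                          ∎
    where
    xyr≤jk : x * y * r ≤ j * k
    xyr≤jk = square-cancel-≤ (begin
      (x * y * r) * (x * y * r)   ≡⟨ ℕ-solve (x ∷ y ∷ r ∷ []) ⟩
      (x * x * r) * (y * y * r)   ≤⟨ ℕP.*-mono-≤ x√r≤j y√r≤k ⟩
      (j * j) * (k * k)           ≡⟨ ℕ-solve (j ∷ k ∷ []) ⟩
      (j * k) * (j * k)           ∎)

  <·√-+ : ∀ {x y j k} → j < x ·√ r → k < y ·√ r → j + k < x + y ·√ r
  <·√-+ {x} {y} {j} {k} j<x√r k<y√r = begin-strict
    (j + k) * (j + k)                          ≡⟨ ℕ-solve (j ∷ k ∷ []) ⟩
    j * j + 2 * (j * k) + k * k
      <⟨ ℕP.+-mono-<-≤ (ℕP.+-mono-<-≤ j<x√r (ℕP.*-monoʳ-≤ 2 (ℕP.<⇒≤ jk<xyr))) (ℕP.<⇒≤ k<y√r) ⟩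
    x * x * r + 2 * (x * y * r) + y * y * r    ≡⟨ ℕ-solve (x ∷ y ∷ r ∷ []) ⟩
    (x + y) * (x + y) * r                      ∎
    where
    jk<xyr : j * k < x * y * r
    jk<xyr = square-cancel-< (begin-strict
      (j * k) * (j * k)           ≡⟨ ℕ-solve (j ∷ k ∷ []) ⟩
      (j * j) * (k * k)           <⟨ ℕP.*-mono-< j<x√r k<y√r ⟩
      (x * x * r) * (y * y * r)   ≡⟨ ℕ-solve (x ∷ y ∷ r ∷ []) ⟩
      (x * y * r) * (x * y * r)   ∎)

  ⌊/√⌋-+ : ∀ {j k a b c} → ⌊ j /√ r ⌋≡ a → ⌊ k /√ r ⌋≡ b → ⌊ j + k /√ r ⌋≡ c
         → c ≡ a + b ⊎ c ≡ suc (a + b)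
  ⌊/√⌋-+ {j} {k} {a} {b} {c} (a√r≤j , j<[1+a]√r) (b√r≤k , k<[1+b]√r) (c√r≤j+k , j+k<[1+c]√r) =
    squeeze a+b≤c c≤1+a+b
    where
    squeeze : ∀ {m n} → m ≤ n → n ≤ suc m → n ≡ m ⊎ n ≡ suc m
    squeeze m≤n n≤1+m with ℕP.m≤n⇒m<n∨m≡n m≤n
    ... | inj₁ m<n = inj₂ (ℕP.≤-antisym n≤1+m m<n)
    ... | inj₂ m≡n = inj₁ (sym m≡n)
    a+b≤c : a + b ≤ c
    a+b≤c = ℕP.≮⇒≥ λ c<a+b → ℕP.<-irrefl refl (begin-strict
      (j + k) * (j + k)          <⟨ j+k<[1+c]√r ⟩
      suc c * suc c * r          ≤⟨ ·√-mono-≤ c<a+b ⟩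
      (a + b) * (a + b) * r      ≤⟨ ·√≤-+ {a} {b} {j} {k} a√r≤j b√r≤k ⟩
      (j + k) * (j + k)          ∎)
    c≤1+a+b : c ≤ suc (a + b)
    c≤1+a+b = ℕP.≮⇒≥ λ 1+a+b<c → ℕP.<-irrefl refl (begin-strict
      (j + k) * (j + k)                          <⟨ <·√-+ {suc a} {suc b} {j} {k} j<[1+a]√r k<[1+b]√r ⟩
      (suc a + suc b) * (suc a + suc b) * r      ≡⟨ cong (λ z → z * z * r) (ℕP.+-suc (suc a) b) ⟩
      suc (suc (a + b)) * suc (suc (a + b)) * r  ≤⟨ ·√-mono-≤ 1+a+b<c ⟩
      c * c * r                                  ≤⟨ c√r≤j+k ⟩
      (j + k) * (j + k)                          ∎)

√-irrational : ∀ {r x k} → ¬ (Σ ℕ λ m → m * m ≡ r) → 0 < k → x * x * r ≢ k * k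
√-irrational {r} {x} {k} nonsquare 0<k x²r≡k² = nonsquare (k′ , sym r≡k′²)
  where
  open ≡-Reasoning
  [ab]²c≡a²cb² : ∀ a b c → a * b * (a * b) * c ≡ a * a * c * (b * b)
  [ab]²c≡a²cb² = ℕ-solve-∀
  [ab]²≡a²b² : ∀ a b → a * b * (a * b) ≡ a * a * (b * b)
  [ab]²≡a²b² = ℕ-solve-∀
  a²c≡[ac]a : ∀ a c → a * a * c ≡ a * c * a
  a²c≡[ac]a = ℕ-solve-∀
  g : ℕ
  g = gcd x k
  instance
    g≢0 : ℕ.NonZero g
    g≢0 = ℕ.≢-nonZero (gcd[m,n]≢0 x k (inj₂ (ℕP.>⇒≢ 0<k)))
    g²≢0 : ℕ.NonZero (g * g)
    g²≢0 = ℕP.m*n≢0 g g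
  x′ k′ : ℕ
  x′ = _∣_.quotient (gcd[m,n]∣m x k)
  k′ = _∣_.quotient (gcd[m,n]∣n x k)
  x≡x′g : x ≡ x′ * g
  x≡x′g = _∣_.equality (gcd[m,n]∣m x k)
  k≡k′g : k ≡ k′ * g
  k≡k′g = _∣_.equality (gcd[m,n]∣n x k)
  coprime : Coprime x′ k′
  coprime = GCD≡1⇒coprime (GCD-* (subst₂ (λ u v → GCD u v (1 * g)) x≡x′g k≡k′g
                                     (subst (GCD x k) (sym (ℕP.*-identityˡ g)) (gcd-GCD x k))))
  x′²r≡k′² : x′ * x′ * r ≡ k′ * k′
  x′²r≡k′² = ℕP.*-cancelʳ-≡ _ _ (g * g) (begin
    x′ * x′ * r * (g * g)     ≡⟨ [ab]²c≡a²cb² x′ g r ⟨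
    (x′ * g) * (x′ * g) * r   ≡⟨ cong (λ u → u * u * r) x≡x′g ⟨
    x * x * r                 ≡⟨ x²r≡k² ⟩
    k * k                     ≡⟨ cong (λ u → u * u) k≡k′g ⟩
    (k′ * g) * (k′ * g)       ≡⟨ [ab]²≡a²b² k′ g ⟩
    k′ * k′ * (g * g)         ∎)
  x′≡1 : x′ ≡ 1
  x′≡1 = coprime (∣-refl , coprime-divisor coprime (divides (x′ * r) (trans (sym x′²r≡k′²) (a²c≡[ac]a x′ r))))
  r≡k′² : r ≡ k′ * k′
  r≡k′² = begin
    r               ≡⟨ ℕP.*-identityˡ r ⟨
    1 * 1 * r       ≡⟨ cong (λ u → u * u * r) x′≡1 ⟨
    x′ * x′ * r     ≡⟨ x′²r≡k′² ⟩
    k′ * k′         ∎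

+-square : ∀ a → + a ℤ.* + a ≡ + (a * a)
+-square a = sym (ℤP.pos-* a a)

+-square-* : ∀ a r → + a ℤ.* + a ℤ.* + r ≡ + (a * a * r)
+-square-* a r = trans (cong (ℤ._* + r) (+-square a)) (sym (ℤP.pos-* (a * a) r))

+<+-⇔ : ∀ {m n} → (+ m ℤ.< + n) ⇔ (m < n)
+<+-⇔ = mk⇔ ℤP.drop‿+<+ +<+

¬0<-+ : ∀ c → ¬ (ℤ.0ℤ ℤ.< ℤ.- + c)
¬0<-+ zero    (+<+ ())
¬0<-+ (suc c) ()

⌊/√⌋-fromℤ : ∀ {r β} n → ¬ (ℤ.0ℤ ℤ.< n × + β ℤ.* + β ℤ.< n ℤ.* n ℤ.* + r)
           → ℤ.0ℤ ℤ.< n ℤ.+ ℤ.1ℤ × + β ℤ.* + β ℤ.< (n ℤ.+ ℤ.1ℤ) ℤ.* (n ℤ.+ ℤ.1ℤ) ℤ.* + r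
           → Σ ℕ λ a → n ≡ + a × ⌊ β /√ r ⌋≡ a
⌊/√⌋-fromℤ {r} {β} (+ a) ¬β<n√r (_ , β<[n+1]√r) = a , refl , a√r≤β , β<[1+a]√r
  where
  0<a : ∀ {a} → β < a ·√ r → 0 < a
  0<a {zero}  ()
  0<a {suc _} _ = s≤s z≤n
  a√r≤β : a ·√ r ≤ β
  a√r≤β = ℕP.≮⇒≥ λ β<a√r → ¬β<n√r (+<+ (0<a β<a√r) ,
            subst₂ ℤ._<_ (sym (+-square β)) (sym (+-square-* a r)) (+<+ β<a√r))
  β<[1+a]√r : β < suc a ·√ r
  β<[1+a]√r = ℤP.drop‿+<+ (subst₂ ℤ._<_ (+-square β)
                (trans (cong (λ m → + m ℤ.* + m ℤ.* + r) (ℕP.+-comm a 1)) (+-square-* (suc a) r)) β<[n+1]√r)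
⌊/√⌋-fromℤ -[1+ zero ]  _ (+<+ () , _)
⌊/√⌋-fromℤ -[1+ suc _ ] _ (() , _)

module _ {c ℓ} (M : CommutativeMonoid c ℓ) where
  open CommutativeMonoid M using (Carrier; _≈_; _∙_; ε; ∙-congˡ; setoid)
  open CommutativeMonoidSum M using (sum-syntax; ∑-distrib-+; ∑-permute; sum-cong-≋)
  open SetoidReasoning setoid

  ∑ₗ : List Carrier → Carrier
  ∑ₗ = foldr _∙_ ε

  ∑ₗ-applyUpTo : ∀ (f : ℕ → Carrier) n → ∑ₗ (applyUpTo f n) ≡ ∑[ i < n ] f (toℕ i)
  ∑ₗ-applyUpTo f zero    = refl
  ∑ₗ-applyUpTo f (suc n) = cong (f 0 ∙_) (∑ₗ-applyUpTo (f ∘ suc) n)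

  ∑ₗ-range : ∀ (f : ℕ → Carrier) n → ∑ₗ (map f (range (suc n))) ≡ ∑[ i < n ] f (suc (toℕ i))
  ∑ₗ-range f n = trans (cong ∑ₗ (trans (sym (map-∘ (upTo n))) (map-upTo (f ∘ suc) n))) (∑ₗ-applyUpTo (f ∘ suc) n)

  ∑ₗ-range-distrib : ∀ n (f g : ℕ → Carrier)
                   → ∑ₗ (map (λ j → f j ∙ g j) (range (suc n)))
                     ≈ ∑ₗ (map f (range (suc n))) ∙ ∑ₗ (map g (range (suc n)))
  ∑ₗ-range-distrib n f g = begin
    ∑ₗ (map (λ j → f j ∙ g j) (range (suc n)))                 ≡⟨ ∑ₗ-range (λ j → f j ∙ g j) n ⟩
    ∑[ i < n ] (f (suc (toℕ i)) ∙ g (suc (toℕ i)))            ≈⟨ ∑-distrib-+ {n} _ _ ⟩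
    ∑[ i < n ] f (suc (toℕ i)) ∙ ∑[ i < n ] g (suc (toℕ i))   ≡⟨ cong₂ _∙_ (∑ₗ-range f n) (∑ₗ-range g n) ⟨
    ∑ₗ (map f (range (suc n))) ∙ ∑ₗ (map g (range (suc n)))    ∎

  ∑ₗ-range-pairs : ∀ n (f g : ℕ → Carrier)
                 → (∀ j k → 1 ≤ j → 1 ≤ k → j + k ≡ suc n → f j ∙ f k ≈ g j)
                 → ∑ₗ (map f (range (suc n))) ∙ ∑ₗ (map f (range (suc n))) ≈ ∑ₗ (map g (range (suc n)))
  ∑ₗ-range-pairs n f g pair = begin
    ∑ₗ (map f (range (suc n))) ∙ ∑ₗ (map f (range (suc n)))   ≡⟨ cong₂ _∙_ (∑ₗ-range f n) (∑ₗ-range f n) ⟩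
    ∑[ i < n ] F i ∙ ∑[ i < n ] F i                         ≈⟨ ∙-congˡ (∑-permute F Perm.reverse) ⟩
    ∑[ i < n ] F i ∙ ∑[ i < n ] F (opposite i)              ≈⟨ ∑-distrib-+ F (F ∘ opposite) ⟨
    ∑[ i < n ] (F i ∙ F (opposite i))                       ≈⟨ sum-cong-≋ pair-opposite ⟩
    ∑[ i < n ] g (suc (toℕ i))                              ≡⟨ ∑ₗ-range g n ⟨
    ∑ₗ (map g (range (suc n)))                              ∎
    where
    F : Fin n → Carrier
    F i = f (suc (toℕ i))
    pair-opposite : ∀ i → F i ∙ F (opposite i) ≈ g (suc (toℕ i))
    pair-opposite i = pair _ _ (s≤s z≤n) (s≤s z≤n)
      (trans (cong (λ m → suc (toℕ i) + suc m) (opposite-prop i))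
             (trans (ℕP.+-suc (suc (toℕ i)) _) (cong suc (ℕP.m+[n∸m]≡n (toℕ<n i)))))

foldr-map-homo : ∀ {A B C : Set} {_∙_ : A → A → A} {e : A} {_◦_ : B → B → B} {e′ : B} (φ : A → B)
               → φ e ≡ e′ → (∀ x y → φ (x ∙ y) ≡ φ x ◦ φ y)
               → ∀ (h : C → A) xs → foldr _◦_ e′ (map (φ ∘ h) xs) ≡ φ (foldr _∙_ e (map h xs))
foldr-map-homo φ φe≡e′ φ-homo h []       = sym φe≡e′
foldr-map-homo {_◦_ = _◦_} φ φe≡e′ φ-homo h (x ∷ xs) =
  trans (cong (φ (h x) ◦_) (foldr-map-homo φ φe≡e′ φ-homo h xs)) (sym (φ-homo (h x) _))

length-range : ∀ n → length (range (suc n)) ≡ n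
length-range n = trans (length-map suc (upTo n)) (length-upTo n)

sumℤ-const : ∀ {A : Set} (xs : List A) c → sumℤ (map (λ _ → c) xs) ≡ + length xs ℤ.* c
sumℤ-const []       c = sym (ℤP.*-zeroˡ c)
sumℤ-const (_ ∷ xs) c = trans (cong (λ z → c ℤ.+ z) (sumℤ-const xs c)) (sym (ℤP.suc-* (+ length xs) c))

𝟙 : Bool → ℤ
𝟙 true  = ℤ.1ℤ
𝟙 false = ℤ.0ℤ

count≡sumℤ-𝟙 : ∀ {A : Set} (p : A → Bool) xs → + count p xs ≡ sumℤ (map (𝟙 ∘ p) xs)
count≡sumℤ-𝟙 p []       = refl
count≡sumℤ-𝟙 p (x ∷ xs) with p x
... | true  = cong (λ z → ℤ.1ℤ ℤ.+ z) (count≡sumℤ-𝟙 p xs)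
... | false = trans (count≡sumℤ-𝟙 p xs) (sym (ℤP.+-identityˡ _))

sumℚ : List ℚ → ℚ
sumℚ = foldr ℚ._+_ 0ℚ

sumQ-⟨,⟩ : ∀ {A : Set} (a b : A → ℚ) xs
         → sumQ (map (λ x → ⟨ a x , b x ⟩) xs) ≡ ⟨ sumℚ (map a xs) , sumℚ (map b xs) ⟩
sumQ-⟨,⟩ a b []       = refl
sumQ-⟨,⟩ a b (x ∷ xs) = cong (⟨ a x , b x ⟩ +Q_) (sumQ-⟨,⟩ a b xs)

ℤ→QS-⟨0,t⟩ : ∀ n t → ℤ→QS n -Q ⟨ 0ℚ , t ⟩ ≡ ⟨ toℚ n , ℚ.- t ⟩
ℤ→QS-⟨0,t⟩ n t = cong₂ ⟨_,_⟩ (ℚP.+-identityʳ (toℚ n)) (ℚP.+-identityˡ (ℚ.- t))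

module _ (r′ : ℕ) where
  private
    r : ℕ
    r = suc r′
    R : ℚ
    R = toℚ (+ r)
    instance
      R-pos : Positive R
      R-pos = ℚP.normalize-pos r 1

  j/r : ℕ → ℚ
  j/r j = + j ℚ./ r

  j/r*r≡j : ∀ j → j/r j ℚ.* R ≡ toℚ (+ j)
  j/r*r≡j j = ℚP.toℚᵘ-injective (begin
    ℚ.toℚᵘ (j/r j ℚ.* R)                  ≈⟨ ℚP.toℚᵘ-homo-* (j/r j) R ⟩
    ℚ.toℚᵘ (j/r j) ℚᵘ.* ℚ.toℚᵘ R          ≈⟨ ℚᵘP.*-cong (ℚP.toℚᵘ-fromℚᵘ (mkℚᵘ (+ j) r′)) (toℚᵘ-toℚ (+ r)) ⟩
    mkℚᵘ (+ j) r′ ℚᵘ.* mkℚᵘ (+ r) 0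
      ≈⟨ *≡* (trans (ℤP.*-identityʳ _) (cong (λ d → + j ℤ.* + suc d) (sym (ℕP.*-identityʳ r′)))) ⟩
    mkℚᵘ (+ j) 0                          ≈⟨ toℚᵘ-toℚ (+ j) ⟨
    ℚ.toℚᵘ (toℚ (+ j))                    ∎)
    where open ℚᵘP.≃-Reasoning

  *r-injective : ∀ {p q} → p ℚ.* R ≡ q ℚ.* R → p ≡ q
  *r-injective pR≡qR = ℚP.≤-antisym (ℚP.*-cancelʳ-≤-pos R (ℚP.≤-reflexive pR≡qR))
                                    (ℚP.*-cancelʳ-≤-pos R (ℚP.≤-reflexive (sym pR≡qR)))

  j/r+k/r≡1 : ∀ {j k} → j + k ≡ r → j/r j ℚ.+ j/r k ≡ 1ℚ
  j/r+k/r≡1 {j} {k} j+k≡r = *r-injective (begin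
    (j/r j ℚ.+ j/r k) ℚ.* R            ≡⟨ ℚP.*-distribʳ-+ R (j/r j) (j/r k) ⟩
    j/r j ℚ.* R ℚ.+ j/r k ℚ.* R        ≡⟨ cong₂ ℚ._+_ (j/r*r≡j j) (j/r*r≡j k) ⟩
    toℚ (+ j) ℚ.+ toℚ (+ k)            ≡⟨ toℚ-homo-+ (+ j) (+ k) ⟨
    toℚ (+ (j + k))                    ≡⟨ cong (toℚ ∘ +_) j+k≡r ⟩
    R                                  ≡⟨ ℚP.*-identityˡ R ⟨
    1ℚ ℚ.* R                           ∎)
    where open ≡-Reasoning

  jc≡⟨0,j/r⟩ : ∀ j → jc r j ≡ ⟨ 0ℚ , j/r j ⟩
  jc≡⟨0,j/r⟩ j = cong₂ ⟨_,_⟩ (ℚP.*-zeroʳ (j/r j)) (ℚP.*-identityʳ (j/r j))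

  IsFloor⇒⌊/√⌋ : ∀ {t β n} → t ℚ.* R ≡ toℚ (+ β) → 0 < β → IsFloor r ⟨ 0ℚ , t ⟩ n
               → Σ ℕ λ a → n ≡ + a × ⌊ β /√ r ⌋≡ a
  IsFloor⇒⌊/√⌋ {t} {β} {n} tr≡β 0<β (n≤x , x<1+n) =
    ⌊/√⌋-fromℤ {r} {β} n (Equivalence.to T-not-⇔ n≤x ∘ Equivalence.from (m-x>0 n))
                         (Equivalence.to (m-x>0 (n ℤ.+ ℤ.1ℤ)) x<1+n)
    where
    m-x>0 : ∀ m → T (isPos r (ℤ→QS m -Q ⟨ 0ℚ , t ⟩)) ⇔ (ℤ.0ℤ ℤ.< m × + β ℤ.* + β ℤ.< m ℤ.* m ℤ.* + r)
    m-x>0 m = ⇔.trans (≡⇒⇔ (cong (T ∘ isPos r) (ℤ→QS-⟨0,t⟩ m t)))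
                      (isPos-[m-β/√r]-⇔ r {t = t} {β = + β} tr≡β (+<+ 0<β) m)

  module Floors (nonsquare : ¬ (Σ ℕ λ m → m * m ≡ r)) (s : ℤ) (s-floor : IsFloor r √ s)
                (fl : ℕ → ℤ) (fl-floor : ∀ j → 1 ≤ j → j ≤ r ∸ 1 → IsFloor r (jc r j) (fl j)) where

    frac<β? : ℕ → Bool
    frac<β? j = isPos r ((√ -Q ℤ→QS s) -Q frac (jc r j) (fl j))

    s≡⌊r/√r⌋ : Σ ℕ λ s′ → s ≡ + s′ × ⌊ r /√ r ⌋≡ s′
    s≡⌊r/√r⌋ = IsFloor⇒⌊/√⌋ {1ℚ} {r} (ℚP.*-identityˡ R) (s≤s z≤n) s-floor

    fl≡⌊j/√r⌋ : ∀ {j k} → 1 ≤ j → 1 ≤ k → j + k ≡ r → Σ ℕ λ a → fl j ≡ + a × ⌊ j /√ r ⌋≡ a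
    fl≡⌊j/√r⌋ {j} 1≤j 1≤k j+k≡r = IsFloor⇒⌊/√⌋ {j/r j} {j} (j/r*r≡j j) 1≤j
      (subst (λ x → IsFloor r x (fl j)) (jc≡⟨0,j/r⟩ j) (fl-floor j 1≤j j≤r∸1))
      where
      j≤r∸1 : j ≤ r ∸ 1
      j≤r∸1 = ℕ.s≤s⁻¹ (subst (j <_) j+k≡r (ℕP.m<m+n j 1≤k))

    β-frac[jc]≡ : ∀ {j k} → j + k ≡ r → (√ -Q ℤ→QS s) -Q frac (jc r j) (fl j) ≡ ⟨ toℚ (fl j ℤ.- s) , j/r k ⟩
    β-frac[jc]≡ {j} {k} j+k≡r = begin
      (√ -Q ℤ→QS s) -Q frac (jc r j) (fl j)
        ≡⟨ cong (λ x → (√ -Q ℤ→QS s) -Q (x -Q ℤ→QS (fl j))) (jc≡⟨0,j/r⟩ j) ⟩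
      (√ -Q ℤ→QS s) -Q (⟨ 0ℚ , j/r j ⟩ -Q ℤ→QS (fl j))   ≡⟨ cong₂ ⟨_,_⟩ rational-part √-part ⟩
      ⟨ toℚ (fl j ℤ.- s) , j/r k ⟩                       ∎
      where
      open ≡-Reasoning
      rational-lemma : ∀ σ a → (0ℚ ℚ.+ ℚ.- σ) ℚ.+ ℚ.- (0ℚ ℚ.+ ℚ.- a) ≡ a ℚ.+ ℚ.- σ
      rational-lemma = solve 2 (λ σ a → (con 0ℚ :+ :- σ) :+ :- (con 0ℚ :+ :- a) := a :+ :- σ) refl
      √-lemma : ∀ t → (1ℚ ℚ.+ ℚ.- 0ℚ) ℚ.+ ℚ.- (t ℚ.+ ℚ.- 0ℚ) ≡ 1ℚ ℚ.- t
      √-lemma = solve 1 (λ t → (con 1ℚ :+ :- con 0ℚ) :+ :- (t :+ :- con 0ℚ) := con 1ℚ :- t) refl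
      cancel-lemma : ∀ t u → (t ℚ.+ u) ℚ.- t ≡ u
      cancel-lemma = solve 2 (λ t u → (t :+ u) :- t := u) refl
      rational-part : (0ℚ ℚ.+ ℚ.- toℚ s) ℚ.+ ℚ.- (0ℚ ℚ.+ ℚ.- toℚ (fl j)) ≡ toℚ (fl j ℤ.- s)
      rational-part = begin
        (0ℚ ℚ.+ ℚ.- toℚ s) ℚ.+ ℚ.- (0ℚ ℚ.+ ℚ.- toℚ (fl j))   ≡⟨ rational-lemma (toℚ s) (toℚ (fl j)) ⟩
        toℚ (fl j) ℚ.+ ℚ.- toℚ s                             ≡⟨ cong (toℚ (fl j) ℚ.+_) (toℚ-homo‿- s) ⟨
        toℚ (fl j) ℚ.+ toℚ (ℤ.- s)                           ≡⟨ toℚ-homo-+ (fl j) (ℤ.- s) ⟨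
        toℚ (fl j ℤ.- s)                                     ∎
      √-part : (1ℚ ℚ.+ ℚ.- 0ℚ) ℚ.+ ℚ.- (j/r j ℚ.+ ℚ.- 0ℚ) ≡ j/r k
      √-part = begin
        (1ℚ ℚ.+ ℚ.- 0ℚ) ℚ.+ ℚ.- (j/r j ℚ.+ ℚ.- 0ℚ)   ≡⟨ √-lemma (j/r j) ⟩
        1ℚ ℚ.- j/r j                                 ≡⟨ cong (ℚ._- j/r j) (j/r+k/r≡1 {j} {k} j+k≡r) ⟨
        (j/r j ℚ.+ j/r k) ℚ.- j/r j                  ≡⟨ cancel-lemma (j/r j) (j/r k) ⟩
        j/r k                                        ∎

    frac<β?-⇔ : ∀ {j k a c} → 0 < k → j + k ≡ r → fl j ≡ + a → s ≡ + (a + c)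
              → T (frac<β? j) ⇔ (c * c * r < k * k)
    frac<β?-⇔ {j} {k} {a} {c} 0<k j+k≡r fl-j≡a s≡a+c =
      ⇔.trans (≡⇒⇔ (cong (T ∘ isPos r) (β-frac[jc]≡ j+k≡r)))
      (⇔.trans (isPos-[m+β/√r]-⇔ r {t = j/r k} {β = + k} (j/r*r≡j k) (+<+ 0<k) (fl j ℤ.- s))
      (⇔.trans (≡⇒⇔ (cong (λ m → ℤ.0ℤ ℤ.< m ⊎ m ℤ.* m ℤ.* + r ℤ.< + k ℤ.* + k) fl-j-s≡-c))
               (mk⇔ [ ⊥-elim ∘ ¬0<-+ c , Equivalence.to c²r<k² ]′ (inj₂ ∘ Equivalence.from c²r<k²))))
      where
      x-[x+y]≡-y : ∀ x y → x ℤ.- (x ℤ.+ y) ≡ ℤ.- y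
      x-[x+y]≡-y = ℤ-solve-∀
      [-x][-x]y≡xxy : ∀ x y → ℤ.- x ℤ.* ℤ.- x ℤ.* y ≡ x ℤ.* x ℤ.* y
      [-x][-x]y≡xxy = ℤ-solve-∀
      fl-j-s≡-c : fl j ℤ.- s ≡ ℤ.- + c
      fl-j-s≡-c = trans (cong₂ ℤ._-_ fl-j≡a s≡a+c) (x-[x+y]≡-y (+ a) (+ c))
      c²r<k² : (ℤ.- + c ℤ.* ℤ.- + c ℤ.* + r ℤ.< + k ℤ.* + k) ⇔ (c * c * r < k * k)
      c²r<k² = ⇔.trans (≡⇒⇔ (cong₂ ℤ._<_ (trans ([-x][-x]y≡xxy (+ c) (+ r)) (+-square-* c r)) (+-square k))) +<+-⇔

    ⌊jc⌋+⌊kc⌋-by-cases : ∀ {j k a b s′} → 1 ≤ k → j + k ≡ r → fl j ≡ + a → fl k ≡ + b → s ≡ + s′ → ⌊ k /√ r ⌋≡ b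
                       → s′ ≡ a + b ⊎ s′ ≡ suc (a + b) → fl j ℤ.+ fl k ≡ (s ℤ.- ℤ.1ℤ) ℤ.+ 𝟙 (frac<β? j)
    ⌊jc⌋+⌊kc⌋-by-cases {j} {k} {a} {b} 1≤k j+k≡r fl-j≡a fl-k≡b s≡s′ ⌊k⌋ (inj₁ s′≡a+b) = begin
      fl j ℤ.+ fl k                         ≡⟨ cong₂ ℤ._+_ fl-j≡a fl-k≡b ⟩
      + (a + b)                             ≡⟨ trans s≡s′ (cong +_ s′≡a+b) ⟨
      s                                     ≡⟨ x≡[x-1]+1 s ⟩
      (s ℤ.- ℤ.1ℤ) ℤ.+ ℤ.1ℤ                 ≡⟨ cong (λ z → (s ℤ.- ℤ.1ℤ) ℤ.+ 𝟙 z) (Equivalence.to T-≡ frac<β) ⟨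
      (s ℤ.- ℤ.1ℤ) ℤ.+ 𝟙 (frac<β? j)        ∎
      where
      open ≡-Reasoning
      x≡[x-1]+1 : ∀ x → x ≡ (x ℤ.- ℤ.1ℤ) ℤ.+ ℤ.1ℤ
      x≡[x-1]+1 = ℤ-solve-∀
      frac<β : T (frac<β? j)
      frac<β = Equivalence.from (frac<β?-⇔ 1≤k j+k≡r fl-j≡a (trans s≡s′ (cong +_ s′≡a+b)))
                 (ℕP.≤∧≢⇒< (proj₁ ⌊k⌋) (√-irrational {r} {b} {k} nonsquare 1≤k))
    ⌊jc⌋+⌊kc⌋-by-cases {j} {k} {a} {b} 1≤k j+k≡r fl-j≡a fl-k≡b s≡s′ ⌊k⌋ (inj₂ s′≡1+a+b) = begin
      fl j ℤ.+ fl k                         ≡⟨ cong₂ ℤ._+_ fl-j≡a fl-k≡b ⟩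
      + (a + b)                             ≡⟨ cong (ℤ._- ℤ.1ℤ) (trans s≡s′ (cong +_ s′≡1+a+b)) ⟨
      s ℤ.- ℤ.1ℤ                            ≡⟨ ℤP.+-identityʳ (s ℤ.- ℤ.1ℤ) ⟨
      (s ℤ.- ℤ.1ℤ) ℤ.+ ℤ.0ℤ                 ≡⟨ cong (λ z → (s ℤ.- ℤ.1ℤ) ℤ.+ 𝟙 z) (Equivalence.to T-not-≡ frac≮β) ⟨
      (s ℤ.- ℤ.1ℤ) ℤ.+ 𝟙 (frac<β? j)        ∎
      where
      open ≡-Reasoning
      s≡a+suc-b : s ≡ + (a + suc b)
      s≡a+suc-b = trans s≡s′ (cong +_ (trans s′≡1+a+b (sym (ℕP.+-suc a b))))
      frac≮β : T (not (frac<β? j))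
      frac≮β = Equivalence.from T-not-⇔ λ frac<β → ℕP.<-asym (proj₂ ⌊k⌋)
        (Equivalence.to (frac<β?-⇔ 1≤k j+k≡r fl-j≡a s≡a+suc-b) frac<β)

    ⌊jc⌋+⌊kc⌋ : ∀ j k → 1 ≤ j → 1 ≤ k → j + k ≡ r → fl j ℤ.+ fl k ≡ (s ℤ.- ℤ.1ℤ) ℤ.+ 𝟙 (frac<β? j)
    ⌊jc⌋+⌊kc⌋ j k 1≤j 1≤k j+k≡r =
      let a , fl-j≡a , ⌊j⌋ = fl≡⌊j/√r⌋ 1≤j 1≤k j+k≡r
          b , fl-k≡b , ⌊k⌋ = fl≡⌊j/√r⌋ 1≤k 1≤j (trans (ℕP.+-comm k j) j+k≡r)
          s′ , s≡s′ , ⌊r⌋  = s≡⌊r/√r⌋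
      in ⌊jc⌋+⌊kc⌋-by-cases 1≤k j+k≡r fl-j≡a fl-k≡b s≡s′ ⌊k⌋
           (⌊/√⌋-+ {r} {j} {k} {a} {b} {s′} ⌊j⌋ ⌊k⌋ (subst (⌊_/√ r ⌋≡ s′) (sym j+k≡r) ⌊r⌋))

    ∑⌊jc⌋ : ℤ
    ∑⌊jc⌋ = sumℤ (map fl (range r))

    N : ℕ
    N = Ncount r s fl

    2∑⌊jc⌋≡ : + 2 ℤ.* ∑⌊jc⌋ ≡ + (r ∸ 1) ℤ.* (s ℤ.- ℤ.1ℤ) ℤ.+ + N
    2∑⌊jc⌋≡ = begin
      + 2 ℤ.* ∑⌊jc⌋                                            ≡⟨ 2x≡x+x ∑⌊jc⌋ ⟩
      ∑⌊jc⌋ ℤ.+ ∑⌊jc⌋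
        ≡⟨ ∑ₗ-range-pairs ℤP.+-0-commutativeMonoid r′ fl _ ⌊jc⌋+⌊kc⌋ ⟩
      sumℤ (map (λ j → (s ℤ.- ℤ.1ℤ) ℤ.+ 𝟙 (frac<β? j)) (range r))
        ≡⟨ ∑ₗ-range-distrib ℤP.+-0-commutativeMonoid r′ (λ _ → s ℤ.- ℤ.1ℤ) (𝟙 ∘ frac<β?) ⟩
      sumℤ (map (λ _ → s ℤ.- ℤ.1ℤ) (range r)) ℤ.+ sumℤ (map (𝟙 ∘ frac<β?) (range r))
        ≡⟨ cong₂ ℤ._+_ (sumℤ-const (range r) (s ℤ.- ℤ.1ℤ)) (sym (count≡sumℤ-𝟙 frac<β? (range r))) ⟩
      + length (range r) ℤ.* (s ℤ.- ℤ.1ℤ) ℤ.+ + N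
        ≡⟨ cong (λ n → + n ℤ.* (s ℤ.- ℤ.1ℤ) ℤ.+ + N) (length-range r′) ⟩
      + r′ ℤ.* (s ℤ.- ℤ.1ℤ) ℤ.+ + N                            ∎
      where
      open ≡-Reasoning
      2x≡x+x : ∀ x → + 2 ℤ.* x ≡ x ℤ.+ x
      2x≡x+x = ℤ-solve-∀

    private
      r-1≡r′ : R ℚ.- 1ℚ ≡ toℚ (+ r′)
      r-1≡r′ = trans (cong (ℚ._- 1ℚ) (toℚ-homo-+ (+ 1) (+ r′))) (lemma (toℚ (+ r′)))
        where
        lemma : ∀ x → 1ℚ ℚ.+ x ℚ.- 1ℚ ≡ x
        lemma = solve 1 (λ x → con 1ℚ :+ x :- con 1ℚ := x) refl

    ∑j/r≡ : sumℚ (map j/r (range r)) ≡ ½ ℚ.* (R ℚ.- 1ℚ)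
    ∑j/r≡ = x+x≡y⇒x≡½y (begin
      sumℚ (map j/r (range r)) ℚ.+ sumℚ (map j/r (range r))
        ≡⟨ ∑ₗ-range-pairs ℚP.+-0-commutativeMonoid r′ j/r (λ _ → 1ℚ) (λ j k _ _ → j/r+k/r≡1 {j} {k}) ⟩
      sumℚ (map (λ _ → toℚ ℤ.1ℤ) (range r))           ≡⟨ foldr-map-homo toℚ refl toℚ-homo-+ (λ _ → ℤ.1ℤ) (range r) ⟩
      toℚ (sumℤ (map (λ _ → ℤ.1ℤ) (range r)))         ≡⟨ cong toℚ (sumℤ-const (range r) ℤ.1ℤ) ⟩
      toℚ (+ length (range r) ℤ.* ℤ.1ℤ)               ≡⟨ cong (λ n → toℚ (+ n ℤ.* ℤ.1ℤ)) (length-range r′) ⟩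
      toℚ (+ r′ ℤ.* ℤ.1ℤ)                             ≡⟨ cong toℚ (ℤP.*-identityʳ (+ r′)) ⟩
      toℚ (+ r′)                                      ≡⟨ r-1≡r′ ⟨
      R ℚ.- 1ℚ                                        ∎)
      where open ≡-Reasoning

    toℚ-∑⌊jc⌋≡ : toℚ ∑⌊jc⌋ ≡ ½ ℚ.* ((R ℚ.- 1ℚ) ℚ.* (toℚ s ℚ.- 1ℚ) ℚ.+ toℚ (+ N))
    toℚ-∑⌊jc⌋≡ = x+x≡y⇒x≡½y (begin
      toℚ ∑⌊jc⌋ ℚ.+ toℚ ∑⌊jc⌋                            ≡⟨ toℚ-homo-+ ∑⌊jc⌋ ∑⌊jc⌋ ⟨
      toℚ (∑⌊jc⌋ ℤ.+ ∑⌊jc⌋)                              ≡⟨ cong toℚ (trans (x+x≡2x ∑⌊jc⌋) 2∑⌊jc⌋≡) ⟩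
      toℚ (+ r′ ℤ.* (s ℤ.- ℤ.1ℤ) ℤ.+ + N)                ≡⟨ toℚ-homo-+ (+ r′ ℤ.* (s ℤ.- ℤ.1ℤ)) (+ N) ⟩
      toℚ (+ r′ ℤ.* (s ℤ.- ℤ.1ℤ)) ℚ.+ toℚ (+ N)          ≡⟨ cong (ℚ._+ toℚ (+ N)) (toℚ-homo-* (+ r′) (s ℤ.- ℤ.1ℤ)) ⟩
      toℚ (+ r′) ℚ.* toℚ (s ℤ.- ℤ.1ℤ) ℚ.+ toℚ (+ N)
        ≡⟨ cong₂ (λ u v → u ℚ.* v ℚ.+ toℚ (+ N)) (sym r-1≡r′) (toℚ-homo-+ s (ℤ.- ℤ.1ℤ)) ⟩
      (R ℚ.- 1ℚ) ℚ.* (toℚ s ℚ.- 1ℚ) ℚ.+ toℚ (+ N)        ∎)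
      where
      open ≡-Reasoning
      x+x≡2x : ∀ x → x ℤ.+ x ≡ + 2 ℤ.* x
      x+x≡2x = ℤ-solve-∀

    ∑frac[jc] : QS
    ∑frac[jc] = sumQ (map (λ j → frac (jc r j) (fl j)) (range r))

    ∑frac[jc]≡ : ∑frac[jc] ≡ ⟨ ℚ.- toℚ ∑⌊jc⌋ , sumℚ (map j/r (range r)) ⟩
    ∑frac[jc]≡ = begin
      ∑frac[jc]                                                  ≡⟨ cong sumQ (map-cong frac≡ (range r)) ⟩
      sumQ (map (λ j → ⟨ ℚ.- toℚ (fl j) , j/r j ⟩) (range r))    ≡⟨ sumQ-⟨,⟩ (ℚ.-_ ∘ toℚ ∘ fl) j/r (range r) ⟩
      ⟨ sumℚ (map (ℚ.-_ ∘ toℚ ∘ fl) (range r)) , sumℚ (map j/r (range r)) ⟩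
        ≡⟨ cong ⟨_, sumℚ (map j/r (range r)) ⟩ (foldr-map-homo (ℚ.-_ ∘ toℚ) refl -toℚ-homo-+ fl (range r)) ⟩
      ⟨ ℚ.- toℚ ∑⌊jc⌋ , sumℚ (map j/r (range r)) ⟩               ∎
      where
      open ≡-Reasoning
      frac≡ : ∀ j → frac (jc r j) (fl j) ≡ ⟨ ℚ.- toℚ (fl j) , j/r j ⟩
      frac≡ j = trans (cong (_-Q ℤ→QS (fl j)) (jc≡⟨0,j/r⟩ j)) (cong₂ ⟨_,_⟩ (ℚP.+-identityˡ _) (ℚP.+-identityʳ _))
      -toℚ-homo-+ : ∀ x y → ℚ.- toℚ (x ℤ.+ y) ≡ ℚ.- toℚ x ℚ.+ ℚ.- toℚ y
      -toℚ-homo-+ x y = trans (cong ℚ.-_ (toℚ-homo-+ x y)) (ℚP.neg-distrib-+ (toℚ x) (toℚ y))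

    rβ+s-1-N : QS
    rβ+s-1-N = (R ·Q (√ -Q ℤ→QS s) +Q ℤ→QS (s ℤ.- ℤ.1ℤ)) -Q ℕ→QS N

    ∑frac[jc]-½[r-√r]≡½[rβ+s-1-N] : ∑frac[jc] -Q (½ ·Q (ℕ→QS r -Q √)) ≡ ½ ·Q rβ+s-1-N
    ∑frac[jc]-½[r-√r]≡½[rβ+s-1-N] = begin
      ∑frac[jc] -Q (½ ·Q (ℕ→QS r -Q √))
        ≡⟨ cong (_-Q (½ ·Q (ℕ→QS r -Q √))) ∑frac[jc]≡ ⟩
      ⟨ ℚ.- toℚ ∑⌊jc⌋ , sumℚ (map j/r (range r)) ⟩ -Q (½ ·Q (ℕ→QS r -Q √))
        ≡⟨ cong₂ (λ φ τ → ⟨ ℚ.- φ , τ ⟩ -Q (½ ·Q (ℕ→QS r -Q √))) toℚ-∑⌊jc⌋≡ ∑j/r≡ ⟩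
      ⟨ ℚ.- (½ ℚ.* ((R ℚ.- 1ℚ) ℚ.* (σ ℚ.- 1ℚ) ℚ.+ ν)) , ½ ℚ.* (R ℚ.- 1ℚ) ⟩ -Q (½ ·Q (ℕ→QS r -Q √))
        ≡⟨ cong₂ ⟨_,_⟩ (rational-part R σ ν) (√-part R) ⟩
      ½ ·Q ((R ·Q (√ -Q ℤ→QS s) +Q ⟨ σ ℚ.- 1ℚ , 0ℚ ⟩) -Q ℕ→QS N)
        ≡⟨ cong (λ u → ½ ·Q ((R ·Q (√ -Q ℤ→QS s) +Q ⟨ u , 0ℚ ⟩) -Q ℕ→QS N)) (toℚ-homo-+ s (ℤ.- ℤ.1ℤ)) ⟨
      ½ ·Q rβ+s-1-N
        ∎
      where
      open ≡-Reasoning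
      σ ν : ℚ
      σ = toℚ s
      ν = toℚ (+ N)
      rational-part : ∀ R σ ν → ℚ.- (½ ℚ.* ((R ℚ.- 1ℚ) ℚ.* (σ ℚ.- 1ℚ) ℚ.+ ν)) ℚ.+ ℚ.- (½ ℚ.* (R ℚ.+ ℚ.- 0ℚ))
                              ≡ ½ ℚ.* ((R ℚ.* (0ℚ ℚ.+ ℚ.- σ) ℚ.+ (σ ℚ.- 1ℚ)) ℚ.+ ℚ.- ν)
      rational-part = solve 3 (λ R σ ν →
          :- (con ½ :* ((R :- con 1ℚ) :* (σ :- con 1ℚ) :+ ν)) :+ :- (con ½ :* (R :+ :- con 0ℚ))
        := con ½ :* ((R :* (con 0ℚ :+ :- σ) :+ (σ :- con 1ℚ)) :+ :- ν)) refl
      √-part : ∀ R → ½ ℚ.* (R ℚ.- 1ℚ) ℚ.+ ℚ.- (½ ℚ.* (0ℚ ℚ.+ ℚ.- 1ℚ))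
                   ≡ ½ ℚ.* ((R ℚ.* (1ℚ ℚ.+ ℚ.- 0ℚ) ℚ.+ 0ℚ) ℚ.+ ℚ.- 0ℚ)
      √-part = solve 1 (λ R → con ½ :* (R :- con 1ℚ) :+ :- (con ½ :* (con 0ℚ :+ :- con 1ℚ))
                             := con ½ :* ((R :* (con 1ℚ :+ :- con 0ℚ) :+ con 0ℚ) :+ :- con 0ℚ)) refl

    rβ+s-1-N>0⇔∑frac[jc]>½[r-√r] : T (isPos r rβ+s-1-N) ⇔ T (isPos r (∑frac[jc] -Q (½ ·Q (ℕ→QS r -Q √))))
    rβ+s-1-N>0⇔∑frac[jc]>½[r-√r] = ⇔.trans (⇔.sym (isPos-scale-⇔ r ½ rβ+s-1-N))
      (≡⇒⇔ (cong (T ∘ isPos r) (sym ∑frac[jc]-½[r-√r]≡½[rβ+s-1-N])))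

lemma3p3 : (r : ℕ) → 2 ≤ r → ¬ (Σ ℕ (λ m → m ℕ.* m ≡ r))
         → (s : ℤ) → IsFloor r √ s
         → (fl : ℕ → ℤ) → (∀ j → 1 ≤ j → j ≤ r ∸ 1 → IsFloor r (jc r j) (fl j))
         → ((ℤ.+ 2) ℤ.* sumℤ (map fl (range r))
              ≡ (ℤ.+ (r ∸ 1)) ℤ.* (s ℤ.- ℤ.1ℤ) ℤ.+ ℤ.+ (Ncount r s fl))
           × ((ℕ→QS (Ncount r s fl)
                 <[ r ] (((ℤ.+ r) ℚ./ 1) ·Q (√ -Q ℤ→QS s) +Q ℤ→QS (s ℤ.- ℤ.1ℤ)))
              ⇔ ((ℚ.½ ·Q (ℕ→QS r -Q √))
                   <[ r ] sumQ (map (λ j → frac (jc r j) (fl j)) (range r))))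
lemma3p3 zero ()
lemma3p3 (suc r′) _ nonsquare s s-floor fl fl-floor = 2∑⌊jc⌋≡ , rβ+s-1-N>0⇔∑frac[jc]>½[r-√r]
  where open Floors r′ nonsquare s s-floor fl fl-floor
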